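{- Let $k,r\ge 2$ be integers, let $q=\frac{r^k-1}{r-1}$, and let $G$ be the complete $k$-partite $k$-uniform hypergraph with parts $U_1,\ldots,U_k$ such that $|U_i|=m^{r^{i-1}/q}$ for $1\le i\le k$ (with $m$ such that these are integers). Then $G$ has $m$ edges, and every subhypergraph of $G$ containing no copy of $K^{(k)}_{r,\ldots,r}$ has $O(m^{(q-1)/q})$ edges, where the implied constant depends only on $k$ and $r$.
   Context: $K^{(k)}_{r,\ldots,r}$ denotes the complete $k$-partite $k$-uniform hypergraph with $k$ parts each of order $r$. The complete $k$-partite $k$-uniform hypergraph with parts $U_1,\dots,U_k$ has as edges all $k$-sets containing exactly one vertex from each $U_i$. -}

module Defs where

open import Data.Nat using (ℕ; zero; suc; _+_; _*_; _^_)
open import Data.Fin using (Fin; zero; suc)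
open import Data.Bool using (Bool; true; false; if_then_else_)
open import Data.List using (List; []; _∷_; concatMap; map; length)
open import Data.Nat.ListAction using (sum)
open import Data.List.Base using (allFin)
open import Data.Product using (Σ; _×_; _,_; ∃)
open import Function.Definitions using (Injective)
open import Relation.Binary.PropositionalEquality using (_≡_)

-- q = (r^k - 1)/(r - 1) = 1 + r + ... + r^(k-1)  (geometric sum, exact for r ≥ 2)
q : ℕ → ℕ → ℕ
q zero    r = 0
q (suc k) r = r ^ k + q k r

-- A k-partite k-uniform hypergraph setting: part i (i : Fin k) is  Fin (n i).
-- An edge of the complete k-partite hypergraph = one vertex from each part,
-- i.e. a tuple (i : Fin k) → Fin (n i).
Tuple : (k : ℕ) → (Fin k → ℕ) → Set
Tuple k n = (i : Fin k) → Fin (n i)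

Vertex : (k : ℕ) → (Fin k → ℕ) → Set
Vertex k n = Σ (Fin k) (λ i → Fin (n i))

consT : ∀ {k} {n : Fin (suc k) → ℕ} → Fin (n zero) → Tuple k (λ i → n (suc i)) → Tuple (suc k) n
consT x xs zero    = x
consT x xs (suc i) = xs i

allTuples : (k : ℕ) (n : Fin k → ℕ) → List (Tuple k n)
allTuples zero    n = (λ ()) ∷ []
allTuples (suc k) n =
  concatMap (λ x → map (consT x) (allTuples k (λ i → n (suc i)))) (allFin (n zero))

Sub : (k : ℕ) → (Fin k → ℕ) → Set
Sub k n = Tuple k n → Bool

edgesG : (k : ℕ) (n : Fin k → ℕ) → ℕ
edgesG k n = length (allTuples k n)

edgesH : (k : ℕ) (n : Fin k → ℕ) → Sub k n → ℕ
edgesH k n H = sum (map (λ x → if H x then 1 else 0) (allTuples k n))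

-- A copy of K^(k)_{r,...,r} in H: an injective map φ from the vertex set
-- Fin k × Fin r of K (part a = {a} × Fin r) into the vertices of G, such that
-- every edge of K (one vertex (a , j a) from each part a) is mapped onto an
-- edge of H, i.e. its image is contained in {(i , x i) | i} for some tuple x
-- with H x ≡ true (both sets have exactly k elements, so they coincide).
HasCopyK : (k r : ℕ) (n : Fin k → ℕ) → Sub k n → Set
HasCopyK k r n H =
  Σ (Fin k × Fin r → Vertex k n) λ φ →
    Injective _≡_ _≡_ φ ×
    ((j : Fin k → Fin r) →
      Σ (Tuple k n) λ x → (H x ≡ true) ×
        ((a : Fin k) → ∃ λ i → φ (a , j a) ≡ (i , x i)))

-- A K_{r,…,r}-free H is bounded one part at a time, as in the Kővári–Sós–Turán
-- argument. For a tuple y of vertices in the parts U₂,…,U_k let d(y) be the number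
-- of x ∈ U₁ with x ∪ y ∈ H. Counting the pairs (S, y) with S ⊆ U₁, |S| = s and
-- S × {y} ⊆ H by the least element of S, and passing to its link, gives by induction
-- on s that Σ_y C(d(y), s) ≤ |U₁|^s E, where E bounds the edges of a K_{r,…,r}-free
-- (k−1)-partite graph on U₂,…,U_k;
-- since d ≤ (r − 1) + C(d, r), this yields e(H) ≤ (r − 1)|U₂|⋯|U_k| + |U₁|^r E.
-- With |U_i| = t^{r^{i−1}} and m = t^q, induction on k gives
-- e(H) ≤ k (r − 1) t^{q−1} = k (r − 1) m^{(q−1)/q}.
module Submission where

open import Defs
open import Data.Nat using (ℕ; _≤_; _^_; _*_; _∸_)
open import Data.Fin using (Fin; toℕ)
open import Data.Product using (Σ; _×_)
open import Relation.Nullary using (¬_)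
open import Relation.Binary.PropositionalEquality using (_≡_)

open import Algebra.Properties.CommutativeSemigroup using (interchange; x∙yz≈y∙xz)
open import Data.Bool using (Bool; true; false; if_then_else_; _∧_; T)
open import Data.Empty using (⊥-elim)
open import Data.Fin using (zero; suc)
open import Data.Fin.Properties using (toℕ-injective)
open import Data.List using (List; []; _∷_; _++_; map; length; concatMap; tabulate; allFin)
open import Data.List.Properties using (map-cong; map-∘; map-++; map-tabulate)
open import Data.Nat using (zero; suc; _+_; _<_; _>_; _<ᵇ_; z≤n; s≤s; NonZero)
open import Data.Nat.Combinatorics using (_C_; nC1≡n; nCk+nC[k+1]≡[n+1]C[k+1])
open import Data.Nat.ListAction using (sum)
open import Data.Nat.ListAction.Properties using (sum-++)
open import Data.Nat.Properties
open import Data.Product using (_,_; proj₁; proj₂; ∃)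
open import Data.Vec.Functional using () renaming (_∷_ to _◂_)
open import Function using (_∘_)
open import Function.Definitions using (Injective)
open import Relation.Binary.Definitions using (tri<; tri≈; tri>)
open import Relation.Binary.PropositionalEquality
  using (_≢_; refl; sym; trans; cong; cong₂; subst; module ≡-Reasoning)
open import Relation.Binary.PropositionalEquality.Properties using (subst-injective)
open import Relation.Nullary using (yes; no)

open import Algebra.Properties.CommutativeMonoid.Sum +-0-commutativeMonoid
  using (sum-syntax; sum-cong-≗; ∑-distrib-+; sum-replicate-zero)

𝟙 : Bool → ℕ
𝟙 b = if b then 1 else 0

∑-mono-≤ : ∀ {t} {f g : Fin t → ℕ} → (∀ i → f i ≤ g i) → ∑[ i < t ] f i ≤ ∑[ i < t ] g i
∑-mono-≤ {zero}  f≤g = z≤n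
∑-mono-≤ {suc t} f≤g = +-mono-≤ (f≤g zero) (∑-mono-≤ (f≤g ∘ suc))

∑-const : ∀ t c → ∑[ i < t ] c ≡ t * c
∑-const zero    c = refl
∑-const (suc t) c = cong (c +_) (∑-const t c)

sum-tabulate : ∀ {t} (f : Fin t → ℕ) → sum (tabulate f) ≡ ∑[ i < t ] f i
sum-tabulate {zero}  f = refl
sum-tabulate {suc t} f = cong (f zero +_) (sum-tabulate (f ∘ suc))

module _ {A : Set} where

  sum-map-mono-≤ : ∀ {f g : A → ℕ} xs → (∀ x → f x ≤ g x) → sum (map f xs) ≤ sum (map g xs)
  sum-map-mono-≤ []       f≤g = z≤n
  sum-map-mono-≤ (x ∷ xs) f≤g = +-mono-≤ (f≤g x) (sum-map-mono-≤ xs f≤g)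

  sum-map-+ : ∀ (f g : A → ℕ) xs →
              sum (map (λ x → f x + g x) xs) ≡ sum (map f xs) + sum (map g xs)
  sum-map-+ f g []       = refl
  sum-map-+ f g (x ∷ xs) = trans (cong (f x + g x +_) (sum-map-+ f g xs))
                                 (interchange +-commutativeSemigroup (f x) (g x) _ _)

  sum-map-const : ∀ c (xs : List A) → sum (map (λ _ → c) xs) ≡ length xs * c
  sum-map-const c []       = refl
  sum-map-const c (x ∷ xs) = cong (c +_) (sum-map-const c xs)

  sum-map-∑ : ∀ {t} (f : Fin t → A → ℕ) xs →
              sum (map (λ x → ∑[ i < t ] f i x) xs) ≡ ∑[ i < t ] sum (map (f i) xs)
  sum-map-∑ {t} f []       = sym (sum-replicate-zero t)
  sum-map-∑     f (x ∷ xs) = trans (cong (_ +_) (sum-map-∑ f xs))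
                                   (sym (∑-distrib-+ (λ i → f i x) (λ i → sum (map (f i) xs))))

  sum-map-concatMap : ∀ {B : Set} (g : B → ℕ) (F : A → List B) xs →
                      sum (map g (concatMap F xs)) ≡ sum (map (λ x → sum (map g (F x))) xs)
  sum-map-concatMap g F []       = refl
  sum-map-concatMap g F (x ∷ xs) = begin
    sum (map g (F x ++ concatMap F xs))                 ≡⟨ cong sum (map-++ g (F x) _) ⟩
    sum (map g (F x) ++ map g (concatMap F xs))         ≡⟨ sum-++ (map g (F x)) _ ⟩
    sum (map g (F x)) + sum (map g (concatMap F xs))    ≡⟨ cong (_ +_) (sum-map-concatMap g F xs) ⟩
    sum (map g (F x)) + sum (map (λ x → sum (map g (F x))) xs) ∎
    where open ≡-Reasoning

sum-allTuples-suc : ∀ k (n : Fin (suc k) → ℕ) (g : Tuple (suc k) n → ℕ) →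
  sum (map g (allTuples (suc k) n)) ≡
  ∑[ x < n zero ] sum (map (λ y → g (consT x y)) (allTuples k (n ∘ suc)))
sum-allTuples-suc k n g = begin
  sum (map g (concatMap (λ x → map (consT x) L) (allFin (n zero))))
    ≡⟨ sum-map-concatMap g _ (allFin (n zero)) ⟩
  sum (map G (allFin (n zero)))
    ≡⟨ cong sum (map-tabulate (λ x → x) G) ⟩
  sum (tabulate G)
    ≡⟨ sum-tabulate G ⟩
  ∑[ x < n zero ] G x
    ≡⟨ sum-cong-≗ {n zero} (λ x → cong sum (sym (map-∘ L))) ⟩
  ∑[ x < n zero ] sum (map (λ y → g (consT x y)) L)
    ∎
  where
  open ≡-Reasoning
  L : List (Tuple k (n ∘ suc))
  L = allTuples k (n ∘ suc)
  G : Fin (n zero) → ℕ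
  G x = sum (map g (map (consT x) L))

edgesG-suc : ∀ k (n : Fin (suc k) → ℕ) → edgesG (suc k) n ≡ n zero * edgesG k (n ∘ suc)
edgesG-suc k n = begin
  edgesG (suc k) n                           ≡⟨ length≡sum (allTuples (suc k) n) ⟩
  sum (map (λ _ → 1) (allTuples (suc k) n))  ≡⟨ sum-allTuples-suc k n (λ _ → 1) ⟩
  ∑[ x < n zero ] sum (map (λ _ → 1) L)      ≡⟨ sum-cong-≗ {n zero} (λ _ → sym (length≡sum L)) ⟩
  ∑[ x < n zero ] edgesG k (n ∘ suc)         ≡⟨ ∑-const (n zero) _ ⟩
  n zero * edgesG k (n ∘ suc)                ∎
  where
  open ≡-Reasoning
  L : List (Tuple k (n ∘ suc))
  L = allTuples k (n ∘ suc)
  length≡sum : ∀ {A : Set} (xs : List A) → length xs ≡ sum (map (λ _ → 1) xs)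
  length≡sum xs = sym (trans (sum-map-const 1 xs) (*-identityʳ (length xs)))

^-distribʳ-* : ∀ m n o → (m * n) ^ o ≡ m ^ o * n ^ o
^-distribʳ-* m n zero    = refl
^-distribʳ-* m n (suc o) = trans (cong (m * n *_) (^-distribʳ-* m n o))
                                 (interchange *-commutativeSemigroup m n (m ^ o) (n ^ o))

^-cancelʳ-≡ : ∀ m n o .{{_ : NonZero o}} → m ^ o ≡ n ^ o → m ≡ n
^-cancelʳ-≡ m n o eq with <-cmp m n
... | tri< m<n _ _ = ⊥-elim (<-irrefl eq (^-monoˡ-< o m<n))
... | tri≈ _ m≡n _ = m≡n
... | tri> _ _ m>n = ⊥-elim (<-irrefl (sym eq) (^-monoˡ-< o m>n))

[m^n]^o≡[m^o]^n : ∀ m n o → (m ^ n) ^ o ≡ (m ^ o) ^ n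
[m^n]^o≡[m^o]^n m n o = begin
  (m ^ n) ^ o  ≡⟨ ^-*-assoc m n o ⟩
  m ^ (n * o)  ≡⟨ cong (m ^_) (*-comm n o) ⟩
  m ^ (o * n)  ≡⟨ sym (^-*-assoc m o n) ⟩
  (m ^ o) ^ n  ∎
  where open ≡-Reasoning

q-suc : ∀ k r → q (suc k) r ≡ suc (r * q k r)
q-suc zero    r = cong suc (sym (*-zeroʳ r))
q-suc (suc k) r = begin
  r * r ^ k + q (suc k) r       ≡⟨ cong (r * r ^ k +_) (q-suc k r) ⟩
  r * r ^ k + suc (r * q k r)   ≡⟨ +-suc _ _ ⟩
  suc (r * r ^ k + r * q k r)   ≡⟨ cong suc (sym (*-distribˡ-+ r (r ^ k) (q k r))) ⟩
  suc (r * q (suc k) r)         ∎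
  where open ≡-Reasoning

geometric-rest : ∀ {k} r t (n : Fin (suc k) → ℕ) → (∀ i → n i ≡ t ^ (r ^ toℕ i)) →
                 ∀ i → n (suc i) ≡ (t ^ r) ^ (r ^ toℕ i)
geometric-rest r t n n≡ i = trans (n≡ (suc i)) (sym (^-*-assoc t r (r ^ toℕ i)))

edgesG-geometric : ∀ r k t (n : Fin k → ℕ) → (∀ i → n i ≡ t ^ (r ^ toℕ i)) → edgesG k n ≡ t ^ q k r
edgesG-geometric r zero    t n n≡ = refl
edgesG-geometric r (suc k) t n n≡ = begin
  edgesG (suc k) n               ≡⟨ edgesG-suc k n ⟩
  n zero * edgesG k (n ∘ suc)
    ≡⟨ cong₂ _*_ (trans (n≡ zero) (*-identityʳ t))
                 (edgesG-geometric r k (t ^ r) (n ∘ suc) (geometric-rest r t n n≡)) ⟩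
  t * (t ^ r) ^ q k r            ≡⟨ cong (t *_) (^-*-assoc t r (q k r)) ⟩
  t ^ suc (r * q k r)            ≡⟨ cong (t ^_) (sym (q-suc k r)) ⟩
  t ^ q (suc k) r                ∎
  where open ≡-Reasoning

k≤n⇒nCk>0 : ∀ {n k} → k ≤ n → n C k > 0
k≤n⇒nCk>0 {n}     {zero}  _         = s≤s z≤n
k≤n⇒nCk>0 {suc n} {suc k} (s≤s k≤n) = begin
  1                     ≤⟨ k≤n⇒nCk>0 k≤n ⟩
  n C k                 ≤⟨ m≤m+n _ _ ⟩
  n C k + n C suc k     ≡⟨ nCk+nC[k+1]≡[n+1]C[k+1] n k ⟩
  suc n C suc k         ∎
  where open ≤-Reasoning

n≤k+nC[1+k] : ∀ k n → n ≤ k + n C suc k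
n≤k+nC[1+k] k zero    = z≤n
n≤k+nC[1+k] k (suc n) with k ≤? n
... | no  k≰n = ≤-trans (≰⇒> k≰n) (m≤m+n k _)
... | yes k≤n = begin
  suc n                        ≤⟨ s≤s (n≤k+nC[1+k] k n) ⟩
  suc (k + n C suc k)          ≡⟨ sym (+-suc k _) ⟩
  k + suc (n C suc k)          ≤⟨ +-monoʳ-≤ k (+-monoˡ-≤ _ (k≤n⇒nCk>0 k≤n)) ⟩
  k + (n C k + n C suc k)      ≡⟨ cong (k +_) (nCk+nC[k+1]≡[n+1]C[k+1] n k) ⟩
  k + suc n C suc k            ∎
  where open ≤-Reasoning

choose-by-least : ∀ s {t} (b : Fin t → Bool) →
  ∑[ x < t ] ((∑[ y < t ] 𝟙 ((toℕ x <ᵇ toℕ y) ∧ b x ∧ b y)) C suc s)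
    ≡ (∑[ x < t ] 𝟙 (b x)) C suc (suc s)
choose-by-least s {zero}  b = refl
choose-by-least s {suc t} b with b zero | choose-by-least s (b ∘ suc)
... | true  | ih = trans (cong₂ _+_ refl ih)
                         (nCk+nC[k+1]≡[n+1]C[k+1] (∑[ x < t ] 𝟙 (b (suc x))) (suc s))
... | false | ih = cong₂ _+_ (cong (_C suc s) (sum-replicate-zero t)) ih

-- The edge through a transversal is asked for only up to pointwise equality, so
-- that the case k = 0 needs no extensionality.
PartiteCopy : (k : ℕ) (sz n : Fin k → ℕ) → Sub k n → Set
PartiteCopy k sz n H =
  Σ ((a : Fin k) → Fin (sz a) → Fin (n a)) λ ψ →
    ((a : Fin k) → Injective _≡_ _≡_ (ψ a)) ×
    ((j : Tuple k sz) → ∃ λ x → H x ≡ true × ((a : Fin k) → x a ≡ ψ a (j a)))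

PartiteCopy-resize : ∀ {k sz sz′} {n : Fin k → ℕ} {H : Sub k n} →
                     (∀ a → sz a ≡ sz′ a) → PartiteCopy k sz n H → PartiteCopy k sz′ n H
PartiteCopy-resize {sz = sz} {sz′} sz≡ (ψ , ψ-inj , edge) =
  (λ a → ψ a ∘ back a) ,
  (λ a → subst-injective (sym (sz≡ a)) ∘ ψ-inj a) ,
  (λ j → edge (λ a → back a (j a)))
  where
  back : ∀ a → Fin (sz′ a) → Fin (sz a)
  back a = subst Fin (sym (sz≡ a))

PartiteCopy⇒HasCopyK : ∀ {k r} {n : Fin k → ℕ} {H : Sub k n} →
                       PartiteCopy k (λ _ → r) n H → HasCopyK k r n H
PartiteCopy⇒HasCopyK {k} {r} {n} {H} (ψ , ψ-inj , edge) = φ , φ-inj , φ-edge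
  where
  φ : Fin k × Fin r → Vertex k n
  φ (a , j) = a , ψ a j
  φ-inj : Injective _≡_ _≡_ φ
  φ-inj {a , j} {b , l} φ≡ with cong proj₁ φ≡
  ... | refl = cong (a ,_) (ψ-inj a (toℕ-injective (cong (λ v → toℕ (proj₂ v)) φ≡)))
  φ-edge : (j : Fin k → Fin r) →
           Σ (Tuple k n) λ x → H x ≡ true × ((a : Fin k) → ∃ λ i → φ (a , j a) ≡ (i , x i))
  φ-edge j with edge j
  ... | x , Hx , x≡ = x , Hx , λ a → a , cong (a ,_) (sym (x≡ a))

edgesH-zero-parts : ∀ {sz n} (H : Sub 0 n) → ¬ PartiteCopy 0 sz n H → edgesH 0 n H ≤ 0
edgesH-zero-parts {n = n} H free = begin
  edgesH 0 n H                             ≤⟨ sum-map-mono-≤ (allTuples 0 n) no-edge ⟩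
  sum (map (λ _ → 0) (allTuples 0 n))      ≡⟨ sum-map-const 0 (allTuples 0 n) ⟩
  1 * 0                                    ∎
  where
  open ≤-Reasoning
  no-edge : ∀ x → 𝟙 (H x) ≤ 0
  no-edge x with H x in Hx
  ... | true  = ⊥-elim (free ((λ ()) , (λ ()) , λ _ → x , Hx , λ ()))
  ... | false = z≤n

module KővariSósTurán {k : ℕ} (n : Fin (suc k) → ℕ) where

  private
    t : ℕ
    t = n zero
    rest : Fin k → ℕ
    rest = n ∘ suc
    L : List (Tuple k rest)
    L = allTuples k rest

  degree : Sub (suc k) n → Tuple k rest → ℕ
  degree H y = ∑[ x < t ] 𝟙 (H (consT x y))

  -- Counts the pairs (S, y) with S an s-subset of the first part and S × {y} ⊆ H.
  stars : ℕ → Sub (suc k) n → ℕ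
  stars s H = sum (map (λ y → degree H y C s) L)

  -- A copy of K_{s,sz} in aboveLink x H lies above x and in the link of x, so
  -- adding x to its first part gives a copy of K_{s+1,sz} in H.
  aboveLink : Fin t → Sub (suc k) n → Sub (suc k) n
  aboveLink x H z = (toℕ x <ᵇ toℕ (z zero)) ∧ H (consT x (λ i → z (suc i))) ∧ H z

  edgesH≡∑degree : ∀ H → edgesH (suc k) n H ≡ sum (map (degree H) L)
  edgesH≡∑degree H = trans (sum-allTuples-suc k n (𝟙 ∘ H))
                           (sym (sum-map-∑ (λ x y → 𝟙 (H (consT x y))) L))

  stars-one : ∀ H → stars 1 H ≡ ∑[ x < t ] edgesH k rest (λ y → H (consT x y))
  stars-one H = trans (cong sum (map-cong (λ y → nC1≡n (degree H y)) L))
                      (sum-map-∑ (λ x y → 𝟙 (H (consT x y))) L)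

  stars-suc : ∀ s H → stars (suc (suc s)) H ≡ ∑[ x < t ] stars (suc s) (aboveLink x H)
  stars-suc s H =
    trans (cong sum (map-cong (λ y → sym (choose-by-least s (λ x → H (consT x y)))) L))
          (sum-map-∑ (λ x y → degree (aboveLink x H) y C suc s) L)

  copy-link : ∀ {sz : Fin k → ℕ} H x → PartiteCopy k sz rest (λ y → H (consT x y)) →
              PartiteCopy (suc k) (1 ◂ sz) n H
  copy-link {sz} H x (ψ , ψ-inj , edge) = ψ′ , ψ′-inj , ψ′-edge
    where
    ψ′ : (a : Fin (suc k)) → Fin ((1 ◂ sz) a) → Fin (n a)
    ψ′ zero    _ = x
    ψ′ (suc a)   = ψ a
    ψ′-inj : ∀ a → Injective _≡_ _≡_ (ψ′ a)
    ψ′-inj zero    {zero} {zero} _ = refl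
    ψ′-inj (suc a)                 = ψ-inj a
    ψ′-edge : (J : Tuple (suc k) (1 ◂ sz)) →
              ∃ λ z → H z ≡ true × ((a : Fin (suc k)) → z a ≡ ψ′ a (J a))
    ψ′-edge J with edge (J ∘ suc)
    ... | y , Hy , y≡ = consT x y , Hy , λ { zero → refl ; (suc a) → y≡ a }

  -- pick makes every part of K_sz nonempty, so each ψ 0 j lies on an edge of
  -- aboveLink x H and is therefore above x.
  copy-above : ∀ {s} {sz : Fin k → ℕ} → Tuple k sz → ∀ H x →
               PartiteCopy (suc k) (suc s ◂ sz) n (aboveLink x H) →
               PartiteCopy (suc k) (suc (suc s) ◂ sz) n H
  copy-above {s} {sz} pick H x (ψ , ψ-inj , edge) = ψ′ , ψ′-inj , ψ′-edge
    where
    ψ′ : (a : Fin (suc k)) → Fin ((suc (suc s) ◂ sz) a) → Fin (n a)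
    ψ′ zero    zero    = x
    ψ′ zero    (suc j) = ψ zero j
    ψ′ (suc a)         = ψ (suc a)

    x<ψ : ∀ j → toℕ x < toℕ (ψ zero j)
    x<ψ j with edge (consT j pick)
    ... | z , above , z≡ with toℕ x <ᵇ toℕ (z zero) in x<z
    ...   | true = subst (λ v → toℕ x < toℕ v) (z≡ zero)
                         (<ᵇ⇒< (toℕ x) (toℕ (z zero)) (subst T (sym x<z) _))

    x≢ψ : ∀ j → x ≢ ψ zero j
    x≢ψ j x≡ψ = <-irrefl (cong toℕ x≡ψ) (x<ψ j)

    ψ′-inj : ∀ a → Injective _≡_ _≡_ (ψ′ a)
    ψ′-inj zero    {zero}  {zero}  _ = refl
    ψ′-inj zero    {zero}  {suc j} p = ⊥-elim (x≢ψ j p)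
    ψ′-inj zero    {suc i} {zero}  p = ⊥-elim (x≢ψ i (sym p))
    ψ′-inj zero    {suc i} {suc j} p = cong suc (ψ-inj zero p)
    ψ′-inj (suc a)                   = ψ-inj (suc a)

    edge-from : ∀ j₀ (J : Tuple k sz) →
                ∃ λ z → H z ≡ true × z zero ≡ ψ′ zero j₀ ×
                        ((a : Fin k) → z (suc a) ≡ ψ (suc a) (J a))
    edge-from zero J with edge (consT zero J)
    ... | z , above , z≡ with toℕ x <ᵇ toℕ (z zero) | H (consT x (λ i → z (suc i))) in Hxz
    ...   | true | true = consT x (λ i → z (suc i)) , Hxz , refl , z≡ ∘ suc
    edge-from (suc j) J with edge (consT j J)
    ... | z , above , z≡ with toℕ x <ᵇ toℕ (z zero) | H (consT x (λ i → z (suc i))) | H z in Hz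
    ...   | true | true | true = z , Hz , z≡ zero , z≡ ∘ suc

    ψ′-edge : (J : Tuple (suc k) (suc (suc s) ◂ sz)) →
              ∃ λ z → H z ≡ true × ((a : Fin (suc k)) → z a ≡ ψ′ a (J a))
    ψ′-edge J with edge-from (J zero) (J ∘ suc)
    ... | z , Hz , z₀≡ , z₊≡ = z , Hz , λ { zero → z₀≡ ; (suc a) → z₊≡ a }

  module _ {sz : Fin k → ℕ} (pick : Tuple k sz) (E : ℕ)
           (edgesH-rest-≤ : ∀ H′ → ¬ PartiteCopy k sz rest H′ → edgesH k rest H′ ≤ E) where

    stars-≤ : ∀ s H → ¬ PartiteCopy (suc k) (suc s ◂ sz) n H → stars (suc s) H ≤ t ^ suc s * E
    stars-≤ zero H free = begin
      stars 1 H                                        ≡⟨ stars-one H ⟩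
      ∑[ x < t ] edgesH k rest (λ y → H (consT x y))
        ≤⟨ ∑-mono-≤ (λ x → edgesH-rest-≤ _ (free ∘ copy-link H x)) ⟩
      ∑[ x < t ] E                                     ≡⟨ ∑-const t E ⟩
      t * E                                            ≡⟨ cong (_* E) (sym (*-identityʳ t)) ⟩
      t ^ 1 * E                                        ∎
      where open ≤-Reasoning
    stars-≤ (suc s) H free = begin
      stars (suc (suc s)) H                            ≡⟨ stars-suc s H ⟩
      ∑[ x < t ] stars (suc s) (aboveLink x H)
        ≤⟨ ∑-mono-≤ (λ x → stars-≤ s (aboveLink x H) (free ∘ copy-above pick H x)) ⟩
      ∑[ x < t ] (t ^ suc s * E)                       ≡⟨ ∑-const t _ ⟩
      t * (t ^ suc s * E)                              ≡⟨ sym (*-assoc t _ E) ⟩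
      t ^ suc (suc s) * E                              ∎
      where open ≤-Reasoning

    edgesH-≤ : ∀ r′ H → ¬ PartiteCopy (suc k) (suc r′ ◂ sz) n H →
               edgesH (suc k) n H ≤ edgesG k rest * r′ + t ^ suc r′ * E
    edgesH-≤ r′ H free = begin
      edgesH (suc k) n H
        ≡⟨ edgesH≡∑degree H ⟩
      sum (map (degree H) L)
        ≤⟨ sum-map-mono-≤ L (λ y → n≤k+nC[1+k] r′ (degree H y)) ⟩
      sum (map (λ y → r′ + degree H y C suc r′) L)
        ≡⟨ sum-map-+ (λ _ → r′) _ L ⟩
      sum (map (λ _ → r′) L) + stars (suc r′) H
        ≡⟨ cong (_+ stars (suc r′) H) (sum-map-const r′ L) ⟩
      edgesG k rest * r′ + stars (suc r′) H
        ≤⟨ +-monoʳ-≤ _ (stars-≤ r′ H free) ⟩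
      edgesG k rest * r′ + t ^ suc r′ * E
        ∎
      where open ≤-Reasoning

module _ (r′ : ℕ) where

  private
    r : ℕ
    r = suc r′

    r◂r≡r : ∀ {k} (a : Fin (suc k)) → (r ◂ (λ (_ : Fin k) → r)) a ≡ r
    r◂r≡r zero    = refl
    r◂r≡r (suc _) = refl

  edgesH-≤-geometric : ∀ k t (n : Fin (suc k) → ℕ) → (∀ i → n i ≡ t ^ (r ^ toℕ i)) →
    ∀ H → ¬ PartiteCopy (suc k) (λ _ → r) n H → edgesH (suc k) n H ≤ suc k * r′ * t ^ (r * q k r)
  edgesH-≤-geometric zero t n n≡ H free = begin
    edgesH 1 n H
      ≤⟨ KővariSósTurán.edgesH-≤ n (λ ()) 0 edgesH-zero-parts r′ H (free ∘ PartiteCopy-resize r◂r≡r) ⟩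
    1 * r′ + n zero ^ r * 0  ≡⟨ cong (1 * r′ +_) (*-zeroʳ (n zero ^ r)) ⟩
    1 * r′ + 0               ≡⟨ +-identityʳ (1 * r′) ⟩
    1 * r′                   ≡⟨ sym (*-identityʳ (1 * r′)) ⟩
    1 * r′ * t ^ 0           ≡⟨ cong (λ e → 1 * r′ * t ^ e) (sym (*-zeroʳ r)) ⟩
    1 * r′ * t ^ (r * 0)     ∎
    where open ≤-Reasoning
  edgesH-≤-geometric (suc k) t n n≡ H free = begin
    edgesH (suc (suc k)) n H
      ≤⟨ KővariSósTurán.edgesH-≤ n (λ _ → zero) E IH r′ H (free ∘ PartiteCopy-resize r◂r≡r) ⟩
    edgesG (suc k) (n ∘ suc) * r′ + n zero ^ r * E
      ≡⟨ cong₂ (λ g u → g * r′ + u ^ r * E) (edgesG-geometric r (suc k) X (n ∘ suc) rest≡)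
                                              (trans (n≡ zero) (*-identityʳ t)) ⟩
    X ^ q (suc k) r * r′ + X * (c * X ^ Q′)
      ≡⟨ cong (λ e → X ^ e * r′ + X * (c * X ^ Q′)) (q-suc k r) ⟩
    X ^ suc Q′ * r′ + X * (c * X ^ Q′)
      ≡⟨ cong₂ _+_ (*-comm (X ^ suc Q′) r′) (x∙yz≈y∙xz *-commutativeSemigroup X c _) ⟩
    r′ * X ^ suc Q′ + c * X ^ suc Q′
      ≡⟨ sym (*-distribʳ-+ (X ^ suc Q′) r′ c) ⟩
    suc (suc k) * r′ * X ^ suc Q′
      ≡⟨ cong (suc (suc k) * r′ *_) (^-*-assoc t r (suc Q′)) ⟩
    suc (suc k) * r′ * t ^ (r * suc Q′)
      ≡⟨ cong (λ e → suc (suc k) * r′ * t ^ (r * e)) (sym (q-suc k r)) ⟩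
    suc (suc k) * r′ * t ^ (r * q (suc k) r)
      ∎
    where
    open ≤-Reasoning
    X Q′ c E : ℕ
    X  = t ^ r
    Q′ = r * q k r
    c  = suc k * r′
    E  = c * X ^ Q′
    rest≡ : ∀ i → n (suc i) ≡ X ^ (r ^ toℕ i)
    rest≡ = geometric-rest r t n n≡
    IH : ∀ H′ → ¬ PartiteCopy (suc k) (λ _ → r) (n ∘ suc) H′ → edgesH (suc k) (n ∘ suc) H′ ≤ E
    IH = edgesH-≤-geometric k X (n ∘ suc) rest≡

module _ {k r Q m : ℕ} .{{_ : NonZero Q}} {n : Fin (suc k) → ℕ}
         (sizes : ∀ i → n i ^ Q ≡ m ^ (r ^ toℕ i)) where

  m≡n₀^Q : m ≡ n zero ^ Q
  m≡n₀^Q = sym (trans (sizes zero) (*-identityʳ m))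

  parts-geometric : ∀ i → n i ≡ n zero ^ (r ^ toℕ i)
  parts-geometric i = ^-cancelʳ-≡ (n i) (n zero ^ (r ^ toℕ i)) Q (begin
    n i ^ Q                      ≡⟨ sizes i ⟩
    m ^ (r ^ toℕ i)              ≡⟨ cong (_^ (r ^ toℕ i)) m≡n₀^Q ⟩
    (n zero ^ Q) ^ (r ^ toℕ i)   ≡⟨ [m^n]^o≡[m^o]^n (n zero) Q (r ^ toℕ i) ⟩
    (n zero ^ (r ^ toℕ i)) ^ Q   ∎)
    where open ≡-Reasoning

theorem3p5 : (k r : ℕ) → 2 ≤ k → 2 ≤ r →
    Σ ℕ λ C →
      (m : ℕ) (n : Fin k → ℕ) →
      ((i : Fin k) → n i ^ q k r ≡ m ^ (r ^ toℕ i)) →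
      (edgesG k n ≡ m) ×
      ((H : Sub k n) → ¬ HasCopyK k r n H →
        edgesH k n H ^ q k r ≤ C * m ^ (q k r ∸ 1))
theorem3p5 (suc k) (suc r′) (s≤s _) (s≤s _) = c ^ Q , λ m n sizes →
  let t = n zero
      m≡t^Q = m≡n₀^Q {r = r} {Q} sizes
      geometric = parts-geometric {r = r} {Q} sizes
      open ≤-Reasoning
  in trans (edgesG-geometric r (suc k) t n geometric) (sym m≡t^Q) ,
  λ H free → begin
    edgesH (suc k) n H ^ Q
      ≤⟨ ^-monoˡ-≤ Q (edgesH-≤-geometric r′ k t n geometric H (free ∘ PartiteCopy⇒HasCopyK)) ⟩
    (c * t ^ Q′) ^ Q       ≡⟨ ^-distribʳ-* c (t ^ Q′) Q ⟩
    c ^ Q * (t ^ Q′) ^ Q   ≡⟨ cong (c ^ Q *_) ([m^n]^o≡[m^o]^n t Q′ Q) ⟩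
    c ^ Q * (t ^ Q) ^ Q′   ≡⟨ cong (λ u → c ^ Q * u ^ Q′) (sym m≡t^Q) ⟩
    c ^ Q * m ^ Q′         ≡⟨ cong (λ e → c ^ Q * m ^ (e ∸ 1)) (sym (q-suc k r)) ⟩
    c ^ Q * m ^ (Q ∸ 1)    ∎
  where
  r Q Q′ c : ℕ
  r  = suc r′
  Q  = q (suc k) r
  Q′ = r * q k r
  c  = suc k * r′
  instance
    Q≢0 : NonZero Q
    Q≢0 = subst NonZero (sym (q-suc k r)) _
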